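{- Let $D$ be any declaration for $\widetilde{\mathcal L}^{\nu}_{\mathsf{iocos}}$ and interpret formulae in the environment $[\![D]\!]_{\max}$. Then for all states $i,s$ of the LTS, $i\mathrel{\mathsf{iocos}}s$ holds if and only if for every $\phi\in\widetilde{\mathcal L}^{\nu}_{\mathsf{iocos}}$, $s\models\phi$ implies $i\models\phi$.
   Context: Actions: disjoint finite sets $I$ (inputs $a?$) and $O$ (outputs $a!$, including quiescence $\delta!$). An LTS with inputs and outputs is $(S,I,O,\to)$ with $\to\subseteq S\times(I\cup O)\times S$ such that $p\xrightarrow{\delta!}p'$ iff $p=p'$ and $p$ has no $a!$-transition for $a!\in O\setminus\{\delta!\}$; LTSs are image-finite. $\mathsf{ins}(p)$ is the set of inputs $a?$ such that $p$ has an $a?$-transition. An iocos-relation $R$ satisfies for every $(p,q)\in R$: (1) $\mathsf{ins}(q)\subseteq\mathsf{ins}(p)$; (2) for every $a?\in\mathsf{ins}(q)$ and $p\xrightarrow{a?}p'$ there is $q\xrightarrow{a?}q'$ with $(p',q')\in R$; (3) for every $a!\in O$ and $p\xrightarrow{a!}p'$ there is $q\xrightarrow{a!}q'$ with $(p',q')\in R$; $\mathsf{iocos}$ is the union of all iocos-relations. Fix a countably infinite set $\mathsf{Var}$ of formula variables. $\widetilde{\mathcal L}^{\nu}_{\mathsf{iocos}}$: $\phi::=X\mid\mathrm{tt}\mid\mathrm{ff}\mid\phi\wedge\phi\mid\phi\vee\phi\mid[\![a?]\!]\phi\mid[a!]\phi$ with $X\in\mathsf{Var}$. For an environment $\sigma:\mathsf{Var}\to\mathcal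 P(S)$: $(\sigma,p)\models X$ iff $p\in\sigma(X)$; Boolean constructs as usual; $(\sigma,p)\models[a!]\phi$ iff $(\sigma,p')\models\phi$ for all $p\xrightarrow{a!}p'$; $(\sigma,p)\models[\![a?]\!]\phi$ iff $p$ has an $a?$-transition and $(\sigma,p')\models\phi$ for all $p\xrightarrow{a?}p'$. Let $[\![\phi]\!]\sigma=\{p\mid(\sigma,p)\models\phi\}$. A declaration is a function $D:\mathsf{Var}\to\widetilde{\mathcal L}^{\nu}_{\mathsf{iocos}}$; it induces the monotone map $[\![D]\!]$ on environments (ordered pointwise by inclusion) given by $([\![D]\!]\sigma)(X)=[\![D(X)]\!]\sigma$, whose greatest fixed point is $[\![D]\!]_{\max}$. We write $p\models\phi$ for $(\,[\![D]\!]_{\max},p)\models\phi$. -}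

module Defs where

open import Data.Nat using (ℕ)
open import Data.Fin using (Fin)
open import Data.Sum using (_⊎_; inj₁; inj₂)
open import Data.Product using (Σ; ∃; _×_; _,_)
open import Data.Unit using (⊤)
open import Data.Empty using (⊥)
open import Data.List using (List)
open import Data.List.Membership.Propositional using (_∈_)
open import Relation.Nullary using (¬_)
open import Relation.Binary.PropositionalEquality using (_≡_; _≢_)

Act : ℕ → ℕ → Set
Act nI nO = Fin nI ⊎ Fin nO

inp : ∀ {nI nO} → Fin nI → Act nI nO
inp = inj₁

out : ∀ {nI nO} → Fin nO → Act nI nO
out = inj₂

record LTS (nI nO : ℕ) : Set₁ where
  field
    S     : Set
    δ     : Fin nO
    _—[_]→_ : S → Act nI nO → S → Set
    quiescence-to   : ∀ p p' → p —[ out δ ]→ p' →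
                      (p ≡ p') × (∀ a p'' → a ≢ δ → ¬ (p —[ out a ]→ p''))
    quiescence-from : ∀ p → (∀ a p'' → a ≢ δ → ¬ (p —[ out a ]→ p'')) →
                      p —[ out δ ]→ p
    image-finite : ∀ p (α : Act nI nO) →
                   Σ (List S) (λ l → ∀ p' → p —[ α ]→ p' → p' ∈ l)

Var : Set
Var = ℕ

data Formula (nI nO : ℕ) : Set where
  var  : Var → Formula nI nO
  tt   : Formula nI nO
  ff   : Formula nI nO
  _∧_  : Formula nI nO → Formula nI nO → Formula nI nO
  _∨_  : Formula nI nO → Formula nI nO → Formula nI nO
  ⟦⟦_?⟧⟧_ : Fin nI → Formula nI nO → Formula nI nO
  [_!]_  : Fin nO → Formula nI nO → Formula nI nO

module _ {nI nO : ℕ} (L : LTS nI nO) where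
  open LTS L

  HasInput : S → Fin nI → Set
  HasInput p a = ∃ λ p' → p —[ inp a ]→ p'

  IsIocosRelation : (S → S → Set) → Set
  IsIocosRelation R = ∀ p q → R p q →
      (∀ a → HasInput q a → HasInput p a)
    × (∀ a → HasInput q a → ∀ p' → p —[ inp a ]→ p' →
         ∃ λ q' → (q —[ inp a ]→ q') × R p' q')
    × (∀ a p' → p —[ out a ]→ p' →
         ∃ λ q' → (q —[ out a ]→ q') × R p' q')

  iocos : S → S → Set₁
  iocos p q = Σ (S → S → Set) λ R → IsIocosRelation R × R p q

  Env : Set₁
  Env = Var → S → Set

  Sat : Env → Formula nI nO → S → Set
  Sat σ (var X) p = σ X p
  Sat σ tt p = ⊤
  Sat σ ff p = ⊥
  Sat σ (φ ∧ ψ) p = Sat σ φ p × Sat σ ψ p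
  Sat σ (φ ∨ ψ) p = Sat σ φ p ⊎ Sat σ ψ p
  Sat σ (⟦⟦ a ?⟧⟧ φ) p = HasInput p a × (∀ p' → p —[ inp a ]→ p' → Sat σ φ p')
  Sat σ ([ a !] φ) p = ∀ p' → p —[ out a ]→ p' → Sat σ φ p'

  _⊆ᴱ_ : Env → Env → Set
  σ ⊆ᴱ τ = ∀ X p → σ X p → τ X p

  ⟦_⟧ᴰ : (Var → Formula nI nO) → Env → Env
  ⟦ D ⟧ᴰ σ X = Sat σ (D X)

  IsGreatestFixedPoint : (Var → Formula nI nO) → Env → Set₁
  IsGreatestFixedPoint D σ =
      (σ ⊆ᴱ ⟦ D ⟧ᴰ σ) × (⟦ D ⟧ᴰ σ ⊆ᴱ σ)
    × (∀ τ → τ ⊆ᴱ ⟦ D ⟧ᴰ τ → τ ⊆ᴱ σ)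

-- Soundness: for an iocos-relation R, the environment that adds to σ(X) every
-- state R-below a state of σ(X) is a post-fixed point of ⟦D⟧, hence contained
-- in the greatest fixed point σ; so satisfaction transfers along R.
-- Completeness: the logical preorder is itself an iocos-relation.  If a move
-- p —α→ p' could not be matched, then each of the finitely many α-successors
-- q' of q satisfies some formula that p' violates; [α] (or ⟦⟦a?⟧⟧) of their
-- disjunction then holds at q but fails at p.
module Submission where

open import Defs
open import Level using (0ℓ)
open import Data.Product using (_×_; ∃; _,_; proj₁; proj₂)
open import Data.Sum using (_⊎_; inj₁; inj₂)
open import Data.Unit using (tt)
open import Data.Empty using (⊥-elim)
open import Data.List using (List; []; _∷_)
open import Data.List.Relation.Unary.Any using (here; there)
open import Data.List.Membership.Propositional using (_∈_)
open import Relation.Nullary using (¬_; yes; no)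
open import Relation.Binary.PropositionalEquality using (refl)
open import Axiom.ExcludedMiddle using (ExcludedMiddle)

module _ {nI nO : _} (L : LTS nI nO) where
  open LTS L

  Sat-mono : ∀ {σ τ : Env L} → _⊆ᴱ_ L σ τ → ∀ φ p → Sat L σ φ p → Sat L τ φ p
  Sat-mono σ⊆τ (var X) p x = σ⊆τ X p x
  Sat-mono σ⊆τ tt p _ = tt
  Sat-mono σ⊆τ (φ ∧ ψ) p (x , y) = Sat-mono σ⊆τ φ p x , Sat-mono σ⊆τ ψ p y
  Sat-mono σ⊆τ (φ ∨ ψ) p (inj₁ x) = inj₁ (Sat-mono σ⊆τ φ p x)
  Sat-mono σ⊆τ (φ ∨ ψ) p (inj₂ y) = inj₂ (Sat-mono σ⊆τ ψ p y)
  Sat-mono σ⊆τ (⟦⟦ a ?⟧⟧ φ) p (has , k) = has , λ p' t → Sat-mono σ⊆τ φ p' (k p' t)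
  Sat-mono σ⊆τ ([ a !] φ) p k = λ p' t → Sat-mono σ⊆τ φ p' (k p' t)

  module Soundness (R : S → S → Set) (isR : IsIocosRelation L R) (σ : Env L) where

    downClosure : Env L
    downClosure X p = σ X p ⊎ ∃ λ q → R p q × σ X q

    Sat-transfer : ∀ φ {p q} → R p q → Sat L σ φ q → Sat L downClosure φ p
    Sat-transfer (var X) {q = q} r x = inj₂ (q , r , x)
    Sat-transfer tt r _ = tt
    Sat-transfer (φ ∧ ψ) r (x , y) = Sat-transfer φ r x , Sat-transfer ψ r y
    Sat-transfer (φ ∨ ψ) r (inj₁ x) = inj₁ (Sat-transfer φ r x)
    Sat-transfer (φ ∨ ψ) r (inj₂ y) = inj₂ (Sat-transfer ψ r y)
    Sat-transfer (⟦⟦ a ?⟧⟧ φ) {p} {q} r (has , k) =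
      proj₁ (isR p q r) a has , λ p' t → matched (proj₁ (proj₂ (isR p q r)) a has p' t)
      where
      matched : ∀ {p'} → ∃ (λ q' → (q —[ inp a ]→ q') × R p' q') → Sat L downClosure φ p'
      matched (q' , t , r') = Sat-transfer φ r' (k q' t)
    Sat-transfer ([ a !] φ) {p} {q} r k =
      λ p' t → matched (proj₂ (proj₂ (isR p q r)) a p' t)
      where
      matched : ∀ {p'} → ∃ (λ q' → (q —[ out a ]→ q') × R p' q') → Sat L downClosure φ p'
      matched (q' , t , r') = Sat-transfer φ r' (k q' t)

    downClosure-postFixed : ∀ D → _⊆ᴱ_ L σ (⟦_⟧ᴰ L D σ) →
                           _⊆ᴱ_ L downClosure (⟦_⟧ᴰ L D downClosure)
    downClosure-postFixed D σ-post X p (inj₁ x) = Sat-mono (λ _ _ → inj₁) (D X) p (σ-post X p x)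
    downClosure-postFixed D σ-post X p (inj₂ (q , r , x)) = Sat-transfer (D X) r (σ-post X q x)

  _≼_ : Env L → S → S → Set
  _≼_ σ p q = ∀ φ → Sat L σ φ q → Sat L σ φ p

  iocos⇒≼ : ∀ D σ → IsGreatestFixedPoint L D σ → ∀ {i s} → iocos L i s → _≼_ σ i s
  iocos⇒≼ D σ (σ-post , _ , σ-max) (R , isR , r) φ sat =
    Sat-mono (σ-max downClosure (downClosure-postFixed D σ-post)) φ _ (Sat-transfer φ r sat)
    where open Soundness R isR σ

  module Completeness (em : ExcludedMiddle 0ℓ) (σ : Env L) where

    distinguish : ∀ {p q} → ¬ _≼_ σ p q → ∃ λ φ → Sat L σ φ q × ¬ Sat L σ φ p
    distinguish {p} {q} p⋠q with em {∃ λ φ → Sat L σ φ q × ¬ Sat L σ φ p}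
    ... | yes witness = witness
    ... | no none = ⊥-elim (p⋠q λ φ sat-q → decide φ sat-q)
      where
      decide : ∀ φ → Sat L σ φ q → Sat L σ φ p
      decide φ sat-q with em {Sat L σ φ p}
      ... | yes sat-p = sat-p
      ... | no unsat-p = ⊥-elim (none (φ , sat-q , unsat-p))

    separate : ∀ {P : S → Set} p (l : List S) → (∀ {q} → q ∈ l → P q → ¬ _≼_ σ p q) →
               ∃ λ Ψ → (∀ {q} → q ∈ l → P q → Sat L σ Ψ q) × ¬ Sat L σ Ψ p
    separate p [] _ = ff , (λ ()) , λ ()
    separate {P} p (x ∷ l) p⋠l with separate p l (λ q∈l → p⋠l (there q∈l)) | em {P x}
    ... | Ψ , sat-l , unsat-p | no ¬Px = Ψ , sat , unsat-p
      where
      sat : ∀ {q} → q ∈ x ∷ l → P q → Sat L σ Ψ q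
      sat (here refl) Px = ⊥-elim (¬Px Px)
      sat (there q∈l) = sat-l q∈l
    ... | Ψ , sat-l , unsat-p | yes Px with distinguish (p⋠l (here refl) Px)
    ...   | φ , sat-x , unsat-φ = φ ∨ Ψ , sat , unsat
      where
      sat : ∀ {q} → q ∈ x ∷ l → P q → Sat L σ (φ ∨ Ψ) q
      sat (here refl) _ = inj₁ sat-x
      sat (there q∈l) Pq = inj₂ (sat-l q∈l Pq)
      unsat : ¬ Sat L σ (φ ∨ Ψ) p
      unsat (inj₁ s) = unsat-φ s
      unsat (inj₂ s) = unsat-p s

    -- □ stands for [a!] or ⟦⟦a?⟧⟧; only its introduction at q and elimination at p are used.
    ≼-simulates : ∀ {p q} α (□ : Formula nI nO → Formula nI nO) → _≼_ σ p q →
      (∀ ψ → (∀ q' → q —[ α ]→ q' → Sat L σ ψ q') → Sat L σ (□ ψ) q) →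
      (∀ ψ → Sat L σ (□ ψ) p → ∀ p' → p —[ α ]→ p' → Sat L σ ψ p') →
      ∀ p' → p —[ α ]→ p' → ∃ λ q' → (q —[ α ]→ q') × _≼_ σ p' q'
    ≼-simulates {p} {q} α □ p≼q □-intro □-elim p' t
      with em {∃ λ q' → (q —[ α ]→ q') × _≼_ σ p' q'}
    ... | yes matched = matched
    ... | no unmatched with image-finite q α
    ...   | succs , covers with separate {q —[ α ]→_} p' succs
                                  (λ _ t' p'≼q' → unmatched (_ , t' , p'≼q'))
    ...     | Ψ , sat-succs , unsat-p' =
      ⊥-elim (unsat-p' (□-elim Ψ (p≼q (□ Ψ) (□-intro Ψ λ q' t' → sat-succs (covers q' t') t')) p' t))

    ≼-isIocosRelation : IsIocosRelation L (_≼_ σ)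
    ≼-isIocosRelation p q p≼q =
        (λ a has-q → proj₁ (p≼q (⟦⟦ a ?⟧⟧ tt) (has-q , λ _ _ → tt)))
      , (λ a has-q → ≼-simulates (inp a) (⟦⟦ a ?⟧⟧_) p≼q (λ _ k → has-q , k) (λ _ → proj₂))
      , (λ a → ≼-simulates (out a) ([ a !]_) p≼q (λ _ k → k) (λ _ k → k))

theorem3 : ExcludedMiddle 0ℓ →
    ∀ {nI nO : _} (L : LTS nI nO) (D : Var → Formula nI nO) (σ : Env L) →
    IsGreatestFixedPoint L D σ →
    ∀ (i s : LTS.S L) →
      (iocos L i s → ∀ φ → Sat L σ φ s → Sat L σ φ i)
      × ((∀ φ → Sat L σ φ s → Sat L σ φ i) → iocos L i s)
theorem3 em L D σ gfp i s =
    iocos⇒≼ L D σ gfp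
  , λ i≼s → _≼_ L σ , Completeness.≼-isIocosRelation L em σ , i≼s
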